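{- Let $H$ be a 3-uniform hypergraph that does not contain $C_4$ as a trace, let $A$ be the set of edges of $H$ containing at least one pair of co-degree $1$ in $H$, and let $B=H\setminus A$. Fix a vertex $v$, and let $e = \{v, u, w\} \in B$ be any edge containing $v$. Then $|V_u \cap V_w| \leq 7$.
   Context: The co-degree $d_H(a,b)$ is the number of edges of $H$ containing $\{a,b\}$. $N_1(v)$ is the set of vertices $z\ne v$ lying in a common edge of $B$ with $v$; $N_2(v)$ is the set of vertices $z\notin N_1(v)\cup\{v\}$ lying in an edge of $B$ that meets $N_1(v)$. For $u\in N_1(v)$, $E_u=\{e\in B: e\cap N_1(v)=\{u\}\}$ and $V_u=\{z\in N_2(v):\exists e\in E_u,\ z\in e\}$. $H$ contains $C_4$ as a trace if there exist distinct vertices $a_1,\dots,a_4$ and four distinct edges $f_1,\dots,f_4$ of $H$ with $f_i\cap\{a_1,\dots,a_4\}=\{a_i,a_{i+1}\}$ (indices mod 4). -}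

module Defs where

open import Data.Nat using (ℕ; zero; suc; _≤_)
open import Data.Fin using (Fin; zero; suc)
open import Data.Fin.Subset using (Subset; _∈_; _∉_; ∣_∣)
open import Data.Fin.Subset.Properties using (_∈?_)
open import Data.List using (List; length; filter)
open import Data.List.Membership.Propositional renaming (_∈_ to _∈ᴸ_)
open import Data.List.Relation.Unary.Unique.Propositional using (Unique)
open import Data.List.Relation.Unary.All using (All)
open import Data.Product using (Σ; ∃; ∃-syntax; _×_; _,_)
open import Data.Sum using (_⊎_)
open import Relation.Nullary using (¬_)
open import Relation.Nullary.Decidable using (_×-dec_)
open import Relation.Binary.PropositionalEquality using (_≡_; _≢_)
open import Function.Definitions using (Injective)
open import Function.Bundles using (_⇔_)

record Hypergraph3 (n : ℕ) : Set where
  field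
    edges    : List (Subset n)
    distinct : Unique edges
    uniform  : All (λ e → ∣ e ∣ ≡ 3) edges
open Hypergraph3 public

module _ {n : ℕ} (H : Hypergraph3 n) where

  codeg : Fin n → Fin n → ℕ
  codeg a b = length (filter (λ e → (a ∈? e) ×-dec (b ∈? e)) (edges H))

  HasCodeg1Pair : Subset n → Set
  HasCodeg1Pair e = ∃[ a ] ∃[ b ] (a ≢ b × a ∈ e × b ∈ e × codeg a b ≡ 1)

  InA : Subset n → Set
  InA e = e ∈ᴸ edges H × HasCodeg1Pair e

  InB : Subset n → Set
  InB e = e ∈ᴸ edges H × ¬ HasCodeg1Pair e

  N1 : Fin n → Fin n → Set
  N1 v z = z ≢ v × ∃[ e ] (InB e × v ∈ e × z ∈ e)

  N2 : Fin n → Fin n → Set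
  N2 v z = ¬ N1 v z × z ≢ v × ∃[ e ] (InB e × z ∈ e × ∃[ y ] (N1 v y × y ∈ e))

  Eu : Fin n → Fin n → Subset n → Set
  Eu v u e = InB e × u ∈ e × N1 v u × (∀ y → y ∈ e → N1 v y → y ≡ u)

  Vu : Fin n → Fin n → Fin n → Set
  Vu v u z = N2 v z × ∃[ e ] (Eu v u e × z ∈ e)

next4 : Fin 4 → Fin 4
next4 zero = suc zero
next4 (suc zero) = suc (suc zero)
next4 (suc (suc zero)) = suc (suc (suc zero))
next4 (suc (suc (suc zero))) = zero

ContainsC4Trace : {n : ℕ} → Hypergraph3 n → Set
ContainsC4Trace {n} H =
  Σ (Fin 4 → Fin n) λ a → Σ (Fin 4 → Subset n) λ f →
    Injective _≡_ _≡_ a × Injective _≡_ _≡_ f ×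
    (∀ i → f i ∈ᴸ edges H) ×
    (∀ i j → (a j ∈ f i) ⇔ (j ≡ i ⊎ j ≡ next4 i))

-- For z ∈ S choose edges through z from E_u and from E_w; the first contains u but not w, the
-- second w but not u, and u, w ∉ S. Say y is linked from x when y lies on one of the two edges
-- chosen for x. If distinct x, y ∈ S are linked in neither direction, then u x w y together with
-- these four edges is a C₄ trace, so linking is total on S. An edge has three vertices and misses
-- S in u (resp. w), so each x links at most 4 elements of S. Counting linked pairs (each unordered
-- pair at least once, x with itself too) gives k(k+1)/2 ≤ 4k for k = |S|, hence k ≤ 7.
module Submission where

open import Defs
open import Data.Nat using (ℕ; _≤_)
open import Data.Fin using (Fin)
open import Data.Fin.Subset using (Subset; _∈_; ∣_∣)
open import Data.Product using (_×_)
open import Relation.Nullary using (¬_)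
open import Relation.Binary.PropositionalEquality using (_≢_)

open import Data.Nat using (zero; suc; pred; _+_; _*_; _<_; z≤n; s≤s; s≤s⁻¹)
open import Data.Nat.Properties
  using (≤-trans; n≤1+n; +-suc; +-assoc; +-monoˡ-≤; +-monoʳ-≤; +-mono-≤; *-distribˡ-+; *-monoʳ-≤; *-comm;
         *-cancelʳ-≤; <⇒≤pred; module ≤-Reasoning)
open import Data.Nat.ListAction using (sum)
open import Data.Nat.Tactic.RingSolver using (solve-∀)
open import Data.Fin using (zero; suc; _≟_)
open import Data.Fin.Properties using (suc-injective)
open import Data.Fin.Subset using (_∉_; _∩_; _∪_; _-_; outside; inside) renaming (⊥ to ∅)
open import Data.Fin.Subset.Properties
  using (_∈?_; p⊂q⇒∣p∣<∣q∣; p∩q⊆p; x∈p∩q⁺; x∈p∩q⁻; x∈p∪q⁺; ∣p∣≤∣x∷p∣;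
         x∈p∧x≢y⇒x∈p-y; x∈p⇒∣p-x∣<∣p∣)
open import Data.Vec using (Vec; _∷_; []; lookup; here; there)
open import Data.Vec.Relation.Unary.All using (All; _∷_; [])
open import Data.Vec.Relation.Unary.All.Properties using (lookup⁺)
open import Data.Vec.Relation.Unary.AllPairs using ([]; _∷_)
import Data.Vec.Relation.Unary.Unique.Propositional as Vec
open import Data.Vec.Relation.Unary.Unique.Propositional.Properties using (lookup-injective)
open import Data.List using (List; []; _∷_; length; filter; map)
open import Data.List.Properties using (filter-accept; length-map)
open import Data.List.Relation.Unary.Any using (here; there)
import Data.List.Relation.Unary.All as All
open import Data.List.Relation.Unary.All.Properties using (map⁺)
open import Data.List.Relation.Unary.Unique.Propositional using (Unique; []; _∷_)
import Data.List.Relation.Unary.Unique.Propositional.Properties as Unique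
open import Data.List.Membership.Propositional using () renaming (_∈_ to _∈ᴸ_)
open import Data.List.Membership.Propositional.Properties using (∈-map⁻; ∈-filter⁻)
open import Data.Product using (Σ; ∃; _,_; proj₁; proj₂; swap)
open import Data.Sum using (_⊎_; inj₁; inj₂; reduce)
import Data.Sum as Sum
open import Data.Empty using (⊥-elim)
open import Function using (_∘_; _⇔_; mk⇔; Equivalence)
open import Relation.Nullary using (Dec; yes; no; contradiction)
open import Relation.Nullary.Decidable using (_⊎-dec_)
open import Relation.Binary.Definitions using (Decidable)
open import Relation.Binary.PropositionalEquality using (_≡_; refl; cong; cong₂; subst; trans; sym; ≢-sym)

+-exchange : ∀ a b c → a + (b + c) ≡ b + (a + c)
+-exchange = solve-∀

[1+k]*[2+k]≡2*[1+k]+k*[1+k] : ∀ k → suc k * suc (suc k) ≡ 2 * suc k + k * suc k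
[1+k]*[2+k]≡2*[1+k]+k*[1+k] = solve-∀

2*[k*d]≡[2*d]*k : ∀ k d → 2 * (k * d) ≡ 2 * d * k
2*[k*d]≡[2*d]*k = solve-∀

sum∘map≤length* : ∀ {A : Set} {f : A → ℕ} {d} xs → (∀ {x} → x ∈ᴸ xs → f x ≤ d) →
                  sum (map f xs) ≤ length xs * d
sum∘map≤length* [] bound = z≤n
sum∘map≤length* (x ∷ xs) bound = +-mono-≤ (bound (here refl)) (sum∘map≤length* xs (bound ∘ there))

module _ {A : Set} {R : A → A → Set} (R? : Decidable R) where

  outdeg : A → List A → ℕ
  outdeg x ys = length (filter (R? x) ys)

  indeg : A → List A → ℕ
  indeg x ys = length (filter (λ y → R? y x) ys)

  arcs : List A → List A → ℕ
  arcs xs ys = sum (map (λ x → outdeg x ys) xs)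

  -- With x = y this makes R reflexive on xs.
  Total : List A → Set
  Total xs = ∀ {x y} → x ∈ᴸ xs → y ∈ᴸ xs → R x y ⊎ R y x

  arcs-∷ʳ : ∀ y xs ys → arcs xs (y ∷ ys) ≡ indeg y xs + arcs xs ys
  arcs-∷ʳ y [] ys = refl
  arcs-∷ʳ y (x ∷ xs) ys with R? x y | trans (cong (outdeg x ys +_) (arcs-∷ʳ y xs ys))
                                        (+-exchange (outdeg x ys) (indeg y xs) (arcs xs ys))
  ... | yes _ | eq = cong suc eq
  ... | no _  | eq = eq

  length≤outdeg+indeg : ∀ x ys → (∀ {y} → y ∈ᴸ ys → R x y ⊎ R y x) →
                        length ys ≤ outdeg x ys + indeg x ys
  length≤outdeg+indeg x [] total = z≤n
  length≤outdeg+indeg x (y ∷ ys) total with R? x y | R? y x | length≤outdeg+indeg x ys (total ∘ there)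
  ... | yes _ | yes _ | le = s≤s (≤-trans le (+-monoʳ-≤ _ (n≤1+n _)))
  ... | yes _ | no _  | le = s≤s le
  ... | no _  | yes _ | le = subst (suc (length ys) ≤_) (sym (+-suc _ _)) (s≤s le)
  ... | no ¬xy | no ¬yx | _ with total (here refl)
  ...   | inj₁ xy = contradiction xy ¬xy
  ...   | inj₂ yx = contradiction yx ¬yx

  suc-length+arcs≤arcs-∷ : ∀ x xs → Total (x ∷ xs) →
                           suc (length xs) + arcs xs xs ≤ arcs (x ∷ xs) (x ∷ xs)
  suc-length+arcs≤arcs-∷ x xs total = begin
    suc (length xs) + arcs xs xs
      ≤⟨ s≤s (+-monoˡ-≤ (arcs xs xs) (length≤outdeg+indeg x xs (total (here refl) ∘ there))) ⟩
    suc (outdeg x xs + indeg x xs) + arcs xs xs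
      ≡⟨ cong suc (+-assoc (outdeg x xs) (indeg x xs) (arcs xs xs)) ⟩
    suc (outdeg x xs + (indeg x xs + arcs xs xs))
      ≡⟨ cong₂ _+_ (sym outdeg-self) (sym (arcs-∷ʳ x xs xs)) ⟩
    outdeg x (x ∷ xs) + arcs xs (x ∷ xs)
      ∎
    where
    open ≤-Reasoning
    outdeg-self : outdeg x (x ∷ xs) ≡ suc (outdeg x xs)
    outdeg-self = cong length (filter-accept (R? x) (reduce (total (here refl) (here refl))))

  length*suc≤2*arcs : ∀ xs → Total xs → length xs * suc (length xs) ≤ 2 * arcs xs xs
  length*suc≤2*arcs [] total = z≤n
  length*suc≤2*arcs (x ∷ xs) total = begin
    suc k * suc (suc k)            ≡⟨ [1+k]*[2+k]≡2*[1+k]+k*[1+k] k ⟩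
    2 * suc k + k * suc k          ≤⟨ +-monoʳ-≤ (2 * suc k) (length*suc≤2*arcs xs (λ p q → total (there p) (there q))) ⟩
    2 * suc k + 2 * arcs xs xs     ≡⟨ sym (*-distribˡ-+ 2 (suc k) (arcs xs xs)) ⟩
    2 * (suc k + arcs xs xs)       ≤⟨ *-monoʳ-≤ 2 (suc-length+arcs≤arcs-∷ x xs total) ⟩
    2 * arcs (x ∷ xs) (x ∷ xs)     ∎
    where
    open ≤-Reasoning
    k = length xs

  length≤pred[2*d] : ∀ d xs → Total xs → (∀ {x} → x ∈ᴸ xs → outdeg x xs ≤ d) →
                     length xs ≤ pred (2 * d)
  length≤pred[2*d] d [] total sparse = z≤n
  length≤pred[2*d] d xs@(_ ∷ _) total sparse = <⇒≤pred (*-cancelʳ-≤ (suc k) (2 * d) k (begin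
    suc k * k           ≡⟨ *-comm (suc k) k ⟩
    k * suc k           ≤⟨ length*suc≤2*arcs xs total ⟩
    2 * arcs xs xs      ≤⟨ *-monoʳ-≤ 2 (sum∘map≤length* xs sparse) ⟩
    2 * (k * d)         ≡⟨ 2*[k*d]≡[2*d]*k k d ⟩
    2 * d * k           ∎))
    where
    open ≤-Reasoning
    k = length xs

∣p∪q∣≤∣p∣+∣q∣ : ∀ {n} (p q : Subset n) → ∣ p ∪ q ∣ ≤ ∣ p ∣ + ∣ q ∣
∣p∪q∣≤∣p∣+∣q∣ [] [] = z≤n
∣p∪q∣≤∣p∣+∣q∣ (outside ∷ p) (outside ∷ q) = ∣p∪q∣≤∣p∣+∣q∣ p q
∣p∪q∣≤∣p∣+∣q∣ (outside ∷ p) (inside ∷ q) =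
  subst (suc ∣ p ∪ q ∣ ≤_) (sym (+-suc ∣ p ∣ ∣ q ∣)) (s≤s (∣p∪q∣≤∣p∣+∣q∣ p q))
∣p∪q∣≤∣p∣+∣q∣ (inside ∷ p) (b ∷ q) =
  s≤s (≤-trans (∣p∪q∣≤∣p∣+∣q∣ p q) (+-monoʳ-≤ ∣ p ∣ (∣p∣≤∣x∷p∣ b q)))

x∈p∧x∉q⇒∣p∩q∣<∣p∣ : ∀ {n} {x : Fin n} {p q : Subset n} → x ∈ p → x ∉ q → ∣ p ∩ q ∣ < ∣ p ∣
x∈p∧x∉q⇒∣p∩q∣<∣p∣ {p = p} {q} x∈p x∉q = p⊂q⇒∣p∣<∣q∣ (p∩q⊆p p q , _ , x∈p , x∉q ∘ proj₂ ∘ x∈p∩q⁻ p q)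

unique⇒length≤∣p∣ : ∀ {n} {xs : List (Fin n)} (p : Subset n) → Unique xs →
                    (∀ {x} → x ∈ᴸ xs → x ∈ p) → length xs ≤ ∣ p ∣
unique⇒length≤∣p∣ p [] xs⊆p = z≤n
unique⇒length≤∣p∣ p (_∷_ {x} {xs} x≢xs xs!) xs⊆p =
  ≤-trans (s≤s (unique⇒length≤∣p∣ (p - x) xs! xs⊆p-x)) (x∈p⇒∣p-x∣<∣p∣ (xs⊆p (here refl)))
  where
  xs⊆p-x : ∀ {y} → y ∈ᴸ xs → y ∈ p - x
  xs⊆p-x y∈xs = x∈p∧x≢y⇒x∈p-y (xs⊆p (there y∈xs)) (All.lookup x≢xs y∈xs ∘ sym)

toList : ∀ {n} → Subset n → List (Fin n)
toList [] = []
toList (outside ∷ p) = map suc (toList p)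
toList (inside ∷ p) = zero ∷ map suc (toList p)

length-toList : ∀ {n} (p : Subset n) → length (toList p) ≡ ∣ p ∣
length-toList [] = refl
length-toList (outside ∷ p) = trans (length-map suc (toList p)) (length-toList p)
length-toList (inside ∷ p) = cong suc (trans (length-map suc (toList p)) (length-toList p))

∈-toList⁻ : ∀ {n} {x : Fin n} (p : Subset n) → x ∈ᴸ toList p → x ∈ p
∈-toList⁻ (outside ∷ p) x∈ with ∈-map⁻ suc x∈
... | _ , y∈ , refl = there (∈-toList⁻ p y∈)
∈-toList⁻ (inside ∷ p) (here refl) = here
∈-toList⁻ (inside ∷ p) (there x∈) with ∈-map⁻ suc x∈
... | _ , y∈ , refl = there (∈-toList⁻ p y∈)

toList-unique : ∀ {n} (p : Subset n) → Unique (toList p)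
toList-unique [] = []
toList-unique (outside ∷ p) = Unique.map⁺ suc-injective (toList-unique p)
toList-unique (inside ∷ p) =
  map⁺ (All.universal (λ _ ()) (toList p)) ∷ Unique.map⁺ suc-injective (toList-unique p)

choice : ∀ {A B : Set} {P : A → Set} (Q : A → B → Set) → (∀ x → Dec (P x)) → B →
         (∀ x → P x → ∃ (Q x)) → Σ (A → B) λ f → ∀ {x} → P x → Q x (f x)
choice {A} {B} {P} Q P? default witness = (λ x → pick x (P? x)) , λ {x} → pick-spec x (P? x)
  where
  pick : ∀ x → Dec (P x) → B
  pick x (yes px) = proj₁ (witness x px)
  pick x (no _) = default
  pick-spec : ∀ x (d : Dec (P x)) → P x → Q x (pick x d)
  pick-spec x (yes px) _ = proj₂ (witness x px)
  pick-spec x (no ¬px) px = contradiction px ¬px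

x∈p∧y∉p⇒x≢y : ∀ {n} {x y : Fin n} {p : Subset n} → x ∈ p → y ∉ p → x ≢ y
x∈p∧y∉p⇒x≢y x∈p y∉p refl = y∉p x∈p

next4≢id : ∀ i → next4 i ≢ i
next4≢id zero ()
next4≢id (suc zero) ()
next4≢id (suc (suc zero)) ()
next4≢id (suc (suc (suc zero))) ()

next4²≢id : ∀ i → next4 (next4 i) ≢ i
next4²≢id zero ()
next4²≢id (suc zero) ()
next4²≢id (suc (suc zero)) ()
next4²≢id (suc (suc (suc zero))) ()

C4Incidence : ∀ {n} → Vec (Fin n) 4 → Vec (Subset n) 4 → Set
C4Incidence a f = ∀ i j → (lookup a j ∈ lookup f i) ⇔ (j ≡ i ⊎ j ≡ next4 i)

module _ {n : ℕ} (H : Hypergraph3 n) where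

  ∣e∩S∣≤2 : ∀ {e S x} → e ∈ᴸ edges H → x ∈ e → x ∉ S → ∣ e ∩ S ∣ ≤ 2
  ∣e∩S∣≤2 {e} {S} e∈H x∈e x∉S =
    s≤s⁻¹ (subst (∣ e ∩ S ∣ <_) (All.lookup (uniform H) e∈H) (x∈p∧x∉q⇒∣p∩q∣<∣p∣ x∈e x∉S))

  -- Distinctness of the edges need not be assumed: an edge containing the corners i and i+1 can only be f i.
  mkC4Trace : (a : Vec (Fin n) 4) (f : Vec (Subset n) 4) →
              Vec.Unique a → All (_∈ᴸ edges H) f → C4Incidence a f → ContainsC4Trace H
  mkC4Trace a f a! f∈H incidence =
    lookup a , lookup f , lookup-injective a! _ _ , f-injective , lookup⁺ f∈H , incidence
    where
    shared-corner : ∀ {i j} → lookup f i ≡ lookup f j → ∀ k → (k ≡ i ⊎ k ≡ next4 i) → k ≡ j ⊎ k ≡ next4 j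
    shared-corner {i} {j} fi≡fj k k∈fi =
      Equivalence.to (incidence j k) (subst (lookup a k ∈_) fi≡fj (Equivalence.from (incidence i k) k∈fi))
    f-injective : ∀ {i j} → lookup f i ≡ lookup f j → i ≡ j
    f-injective {i} {j} fi≡fj with shared-corner fi≡fj i (inj₁ refl) | shared-corner fi≡fj (next4 i) (inj₂ refl)
    ... | inj₁ i≡j | _ = i≡j
    ... | inj₂ refl | inj₁ eq = contradiction eq (next4²≢id j)
    ... | inj₂ refl | inj₂ eq = contradiction eq (next4≢id (next4 j))

-- For z ∈ V_u ∩ V_w the paper's edges of E_u through z give a fan with hub u avoiding w.
record Fan {n} (H : Hypergraph3 n) (hub avoided : Fin n) (S : Subset n) : Set where
  field
    edge         : Fin n → Subset n
    edge∈H       : ∀ {z} → z ∈ S → edge z ∈ᴸ edges H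
    z∈edge       : ∀ {z} → z ∈ S → z ∈ edge z
    hub∈edge     : ∀ {z} → z ∈ S → hub ∈ edge z
    avoided∉edge : ∀ {z} → z ∈ S → avoided ∉ edge z

module _ {n : ℕ} {H : Hypergraph3 n} {u w : Fin n} {S : Subset n}
         (U : Fan H u w S) (W : Fan H w u S) (u∉S : u ∉ S) (w∉S : w ∉ S) where

  open Fan

  Linked : Fin n → Fin n → Set
  Linked x y = y ∈ edge U x ⊎ y ∈ edge W x

  linked? : Decidable Linked
  linked? x y = (y ∈? edge U x) ⊎-dec (y ∈? edge W x)

  unlinked⇒C4Trace : ∀ {x y} → x ∈ S → y ∈ S → x ≢ y → ¬ Linked x y → ¬ Linked y x → ContainsC4Trace H
  unlinked⇒C4Trace {x} {y} x∈S y∈S x≢y ¬x→y ¬y→x =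
    mkC4Trace H (u ∷ x ∷ w ∷ y ∷ []) (edge U x ∷ edge W x ∷ edge W y ∷ edge U y ∷ [])
      corners-distinct (edge∈H U x∈S ∷ edge∈H W x∈S ∷ edge∈H W y∈S ∷ edge∈H U y∈S ∷ []) incidence
    where
    corners-distinct : Vec.Unique (u ∷ x ∷ w ∷ y ∷ [])
    corners-distinct =
        (≢-sym (x∈p∧y∉p⇒x≢y x∈S u∉S) ∷ x∈p∧y∉p⇒x≢y (hub∈edge U x∈S) (avoided∉edge U x∈S)
                                       ∷ ≢-sym (x∈p∧y∉p⇒x≢y y∈S u∉S) ∷ [])
      ∷ (x∈p∧y∉p⇒x≢y x∈S w∉S ∷ x≢y ∷ [])
      ∷ (≢-sym (x∈p∧y∉p⇒x≢y y∈S w∉S) ∷ [])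
      ∷ [] ∷ []
    on : ∀ {i} {t : Fin n} {e} → t ∈ e → (t ∈ e) ⇔ (i ≡ i ⊎ i ≡ next4 i)
    on t∈e = mk⇔ (λ _ → inj₁ refl) (λ _ → t∈e)
    next : ∀ {i} {t : Fin n} {e} → t ∈ e → (t ∈ e) ⇔ (next4 i ≡ i ⊎ next4 i ≡ next4 i)
    next t∈e = mk⇔ (λ _ → inj₂ refl) (λ _ → t∈e)
    off : ∀ {i j} {t : Fin n} {e} → t ∉ e → j ≢ i → j ≢ next4 i → (t ∈ e) ⇔ (j ≡ i ⊎ j ≡ next4 i)
    off t∉e j≢i j≢i+1 = mk⇔ (⊥-elim ∘ t∉e) Sum.[ ⊥-elim ∘ j≢i , ⊥-elim ∘ j≢i+1 ]
    incidence : C4Incidence (u ∷ x ∷ w ∷ y ∷ []) (edge U x ∷ edge W x ∷ edge W y ∷ edge U y ∷ [])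
    incidence zero zero = on (hub∈edge U x∈S)
    incidence zero (suc zero) = next {zero} (z∈edge U x∈S)
    incidence zero (suc (suc zero)) = off (avoided∉edge U x∈S) (λ ()) (λ ())
    incidence zero (suc (suc (suc zero))) = off (¬x→y ∘ inj₁) (λ ()) (λ ())
    incidence (suc zero) zero = off (avoided∉edge W x∈S) (λ ()) (λ ())
    incidence (suc zero) (suc zero) = on (z∈edge W x∈S)
    incidence (suc zero) (suc (suc zero)) = next {suc zero} (hub∈edge W x∈S)
    incidence (suc zero) (suc (suc (suc zero))) = off (¬x→y ∘ inj₂) (λ ()) (λ ())
    incidence (suc (suc zero)) zero = off (avoided∉edge W y∈S) (λ ()) (λ ())
    incidence (suc (suc zero)) (suc zero) = off (¬y→x ∘ inj₂) (λ ()) (λ ())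
    incidence (suc (suc zero)) (suc (suc zero)) = on (hub∈edge W y∈S)
    incidence (suc (suc zero)) (suc (suc (suc zero))) = next {suc (suc zero)} (z∈edge W y∈S)
    incidence (suc (suc (suc zero))) zero = next {suc (suc (suc zero))} (hub∈edge U y∈S)
    incidence (suc (suc (suc zero))) (suc zero) = off (¬y→x ∘ inj₁) (λ ()) (λ ())
    incidence (suc (suc (suc zero))) (suc (suc zero)) = off (avoided∉edge U y∈S) (λ ()) (λ ())
    incidence (suc (suc (suc zero))) (suc (suc (suc zero))) = on (z∈edge U y∈S)

  linked-total : ¬ ContainsC4Trace H → ∀ {x y} → x ∈ S → y ∈ S → Linked x y ⊎ Linked y x
  linked-total noC4 {x} {y} x∈S y∈S with x ≟ y | linked? x y | linked? y x
  ... | yes refl | _ | _ = inj₁ (inj₁ (z∈edge U x∈S))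
  ... | no _ | yes x→y | _ = inj₁ x→y
  ... | no _ | no _ | yes y→x = inj₂ y→x
  ... | no x≢y | no ¬x→y | no ¬y→x = contradiction (unlinked⇒C4Trace x∈S y∈S x≢y ¬x→y ¬y→x) noC4

  links : Fin n → Subset n
  links x = (edge U x ∩ S) ∪ (edge W x ∩ S)

  ∣links∣≤4 : ∀ {x} → x ∈ S → ∣ links x ∣ ≤ 4
  ∣links∣≤4 {x} x∈S = ≤-trans (∣p∪q∣≤∣p∣+∣q∣ (edge U x ∩ S) (edge W x ∩ S))
    (+-mono-≤ (∣e∩S∣≤2 H (edge∈H U x∈S) (hub∈edge U x∈S) u∉S)
              (∣e∩S∣≤2 H (edge∈H W x∈S) (hub∈edge W x∈S) w∉S))

  outdeg≤∣links∣ : ∀ x → outdeg linked? x (toList S) ≤ ∣ links x ∣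
  outdeg≤∣links∣ x = unique⇒length≤∣p∣ (links x) (Unique.filter⁺ (linked? x) (toList-unique S)) linked⇒∈links
    where
    linked⇒∈links : ∀ {y} → y ∈ᴸ filter (linked? x) (toList S) → y ∈ links x
    linked⇒∈links y∈ with ∈-filter⁻ (linked? x) y∈
    ... | y∈S , x→y = x∈p∪q⁺ (Sum.map (λ y∈U → x∈p∩q⁺ (y∈U , ∈-toList⁻ S y∈S))
                                       (λ y∈W → x∈p∩q⁺ (y∈W , ∈-toList⁻ S y∈S)) x→y)

  ∣S∣≤7 : ¬ ContainsC4Trace H → ∣ S ∣ ≤ 7
  ∣S∣≤7 noC4 = subst (_≤ 7) (length-toList S)
    (length≤pred[2*d] linked? 4 (toList S)
      (λ x∈ y∈ → linked-total noC4 (∈-toList⁻ S x∈) (∈-toList⁻ S y∈))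
      (λ x∈ → ≤-trans (outdeg≤∣links∣ _) (∣links∣≤4 (∈-toList⁻ S x∈))))

module _ {n : ℕ} (H : Hypergraph3 n) (v : Fin n) where

  Vu-irrefl : ∀ {u} → ¬ Vu H v u u
  Vu-irrefl ((¬N1[u] , _) , _ , (_ , _ , N1[u] , _) , _) = ¬N1[u] N1[u]

  fan : ∀ {u w S} → u ≢ w → (∀ z → z ∈ S → Vu H v u z × Vu H v w z) → Fan H u w S
  fan {u} {w} {S} u≢w V∩V = record
    { edge = proj₁ chosen
    ; edge∈H = λ z∈S → let ((e∈H , _) , _) , _ = proj₂ chosen z∈S in e∈H
    ; z∈edge = λ z∈S → proj₂ (proj₂ chosen z∈S)
    ; hub∈edge = λ z∈S → let (_ , u∈e , _) , _ = proj₂ chosen z∈S in u∈e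
    ; avoided∉edge = λ z∈S w∈e →
        let (_ , _ , _ , only-u) , _ = proj₂ chosen z∈S in u≢w (sym (only-u _ w∈e (N1[w] z∈S)))
    }
    where
    chosen : Σ (Fin n → Subset n) λ f → ∀ {z} → z ∈ S → Eu H v u (f z) × z ∈ f z
    chosen = choice (λ z e → Eu H v u e × z ∈ e) (_∈? S) ∅ (λ z z∈S → proj₂ (proj₁ (V∩V z z∈S)))
    N1[w] : ∀ {z} → z ∈ S → N1 H v w
    N1[w] {z} z∈S = let _ , _ , (_ , _ , N1[w] , _) , _ = proj₂ (V∩V z z∈S) in N1[w]

corollary6p2 : (n : ℕ) (H : Hypergraph3 n) → ¬ ContainsC4Trace H →
    (v u w : Fin n) (e : Subset n) → InB H e →
    v ≢ u → v ≢ w → u ≢ w → v ∈ e → u ∈ e → w ∈ e →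
    (S : Subset n) → (∀ z → z ∈ S → Vu H v u z × Vu H v w z) → ∣ S ∣ ≤ 7
corollary6p2 n H noC4 v u w e e∈B v≢u v≢w u≢w v∈e u∈e w∈e S V∩V =
  ∣S∣≤7 (fan H v u≢w V∩V) (fan H v (≢-sym u≢w) (λ z → swap ∘ V∩V z))
        (λ u∈S → Vu-irrefl H v (proj₁ (V∩V u u∈S)))
        (λ w∈S → Vu-irrefl H v (proj₂ (V∩V w w∈S)))
        noC4
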